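{- For every closed $\mathrm{BCCSP}_{\|}$ term $p$ there is a closed BCCSP term $q$ (one with no occurrence of $\|$) such that $\mathcal{E}_{\mathtt{CT}}\vdash p\approx q$, where $\mathcal{E}_{\mathtt{CT}}=\mathcal{E}_1\cup\{\mathrm{CT},\mathrm{CTP},\mathrm{EL1}\}$.
   Context: Let $\mathcal{A}$ be a finite non-empty set of actions and $\mathcal{V}$ a countably infinite set of variables. $\mathrm{BCCSP}_{\|}$ terms: $t ::= \mathbf{0} \mid x \mid a.t \mid t+t \mid t \,\|\, t$ ($a\in\mathcal{A}$, $x \in \mathcal{V}$; $ax$ means $a.x$); BCCSP terms are those without $\|$; closed terms contain no variables. $\mathcal{E}\vdash t\approx u$: derivable in equational logic (reflexivity, symmetry, transitivity, substitution instances of axioms, closure under $a.\_$, $+$, $\|$). Axioms with concrete action names stand for all instances with actions from $\mathcal{A}$. $\mathcal{E}_1$: A0 $x+\mathbf{0}\approx x$; A1 $x+y\approx y+x$; A2 $(x+y)+z \approx x+(y+z)$; A3 $x+x\approx x$; P0 $x\|\mathbf{0}\approx x$; P1 $x\|y \approx y \| x$. CT: $a(bx+z)+a(cy+w)\approx a(bx+cy+z+w)$. CTP: $(ax+by+w)\|z\approx(ax+w)\|z+(by+w)\|z$. EL1: $ax\|by\approx a(x\|by)+b(ax\|y)$. -}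

module Defs where

open import Data.Nat using (ℕ; suc)
open import Data.Fin using (Fin)

module Terms (n : ℕ) where

  Act : Set
  Act = Fin (suc n)

  Var : Set
  Var = ℕ

  infixr 8 _·_
  infixl 6 _+ₜ_
  infixl 5 _∥_

  data Term : Set where
    𝟎    : Term
    var  : Var → Term
    _·_  : Act → Term → Term
    _+ₜ_ : Term → Term → Term
    _∥_  : Term → Term → Term

  data Closed : Term → Set where
    𝟎    : Closed 𝟎
    _·_  : ∀ a {t} → Closed t → Closed (a · t)
    _+ₜ_ : ∀ {t u} → Closed t → Closed u → Closed (t +ₜ u)
    _∥_  : ∀ {t u} → Closed t → Closed u → Closed (t ∥ u)

  data BCCSP : Term → Set where
    𝟎    : BCCSP 𝟎
    var  : ∀ x → BCCSP (var x)
    _·_  : ∀ a {t} → BCCSP t → BCCSP (a · t)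
    _+ₜ_ : ∀ {t u} → BCCSP t → BCCSP u → BCCSP (t +ₜ u)

  data AxCT : Term → Term → Set where
    A0  : ∀ x → AxCT (x +ₜ 𝟎) x
    A1  : ∀ x y → AxCT (x +ₜ y) (y +ₜ x)
    A2  : ∀ x y z → AxCT ((x +ₜ y) +ₜ z) (x +ₜ (y +ₜ z))
    A3  : ∀ x → AxCT (x +ₜ x) x
    P0  : ∀ x → AxCT (x ∥ 𝟎) x
    P1  : ∀ x y → AxCT (x ∥ y) (y ∥ x)
    CT  : ∀ a b c x y z w →
          AxCT ((a · (b · x +ₜ z)) +ₜ (a · (c · y +ₜ w)))
               (a · (b · x +ₜ c · y +ₜ z +ₜ w))
    CTP : ∀ a b x y w z →
          AxCT ((a · x +ₜ b · y +ₜ w) ∥ z)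
               (((a · x +ₜ w) ∥ z) +ₜ ((b · y +ₜ w) ∥ z))
    EL1 : ∀ a b x y →
          AxCT ((a · x) ∥ (b · y))
               (a · (x ∥ (b · y)) +ₜ b · ((a · x) ∥ y))

  infix 4 _⊢_≈_
  data _⊢_≈_ (Ax : Term → Term → Set) : Term → Term → Set where
    ax    : ∀ {t u} → Ax t u → Ax ⊢ t ≈ u
    refl  : ∀ {t} → Ax ⊢ t ≈ t
    sym   : ∀ {t u} → Ax ⊢ t ≈ u → Ax ⊢ u ≈ t
    trans : ∀ {t u v} → Ax ⊢ t ≈ u → Ax ⊢ u ≈ v → Ax ⊢ t ≈ v
    pre   : ∀ a {t u} → Ax ⊢ t ≈ u → Ax ⊢ a · t ≈ a · u
    plus  : ∀ {t t' u u'} → Ax ⊢ t ≈ t' → Ax ⊢ u ≈ u' → Ax ⊢ t +ₜ u ≈ t' +ₜ u'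
    par   : ∀ {t t' u u'} → Ax ⊢ t ≈ t' → Ax ⊢ u ≈ u' → Ax ⊢ t ∥ u ≈ t' ∥ u'

-- Every closed term is provably equal to a normal form a₁·p₁ + (a₂·p₂ + (… + 𝟎)) with
-- each pᵢ again a normal form, which is closed and free of ∥. Normal forms are closed
-- under + by A0–A2 and under prefixing. For ∥, the axiom P1 makes it enough to treat
-- a prefix on the left: CTP, with A3 merging the duplicated remainder, distributes ∥
-- over a sum of at least two summands, P0 disposes of 𝟎, and EL1 expands a·p ∥ b·q
-- into a(p ∥ b·q) + b(a·p ∥ q), where each recursive call shrinks one operand.
module Submission where

open import Defs
open import Data.Nat using (ℕ)
open import Data.Product using (Σ; _×_; _,_)
open import Relation.Binary.Bundles using (Setoid)
import Relation.Binary.Reasoning.Setoid as SetoidReasoning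

module NormalForms (n : ℕ) where
  open Terms n

  ≈-setoid : Setoid _ _
  ≈-setoid = record
    { Carrier       = Term
    ; _≈_           = AxCT ⊢_≈_
    ; isEquivalence = record { refl = refl ; sym = sym ; trans = trans }
    }

  open SetoidReasoning ≈-setoid using (begin_; step-≈-⟩; step-≈-⟨; _∎)

  data Normal : Term → Set where
    nil  : Normal 𝟎
    cons : ∀ a {p s} → Normal p → Normal s → Normal (a · p +ₜ s)

  Normal⇒Closed : ∀ {r} → Normal r → Closed r
  Normal⇒Closed nil            = 𝟎
  Normal⇒Closed (cons a Np Ns) = (a · Normal⇒Closed Np) +ₜ Normal⇒Closed Ns

  Normal⇒BCCSP : ∀ {r} → Normal r → BCCSP r
  Normal⇒BCCSP nil            = 𝟎
  Normal⇒BCCSP (cons a Np Ns) = (a · Normal⇒BCCSP Np) +ₜ Normal⇒BCCSP Ns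

  data NormalForm (t : Term) : Set where
    normalForm : ∀ {r} → Normal r → AxCT ⊢ t ≈ r → NormalForm t

  NormalForm-resp : ∀ {t u} → AxCT ⊢ t ≈ u → NormalForm u → NormalForm t
  NormalForm-resp t≈u (normalForm Nr u≈r) = normalForm Nr (trans t≈u u≈r)

  prefix-normalForm : ∀ a {t} → NormalForm t → NormalForm (a · t)
  prefix-normalForm a (normalForm Nr t≈r) =
    normalForm (cons a Nr nil) (trans (pre a t≈r) (sym (ax (A0 _))))

  +-normal : ∀ {s t} → Normal s → Normal t → NormalForm (s +ₜ t)
  +-normal {t = t} nil Nt = normalForm Nt (trans (ax (A1 𝟎 t)) (ax (A0 t)))
  +-normal {t = t} (cons a {p} {s} Np Ns) Nt with +-normal Ns Nt
  ... | normalForm Nr s+t≈r =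
    normalForm (cons a Np Nr) (trans (ax (A2 (a · p) s t)) (plus refl s+t≈r))

  +-normalForm : ∀ {s t} → NormalForm s → NormalForm t → NormalForm (s +ₜ t)
  +-normalForm (normalForm Nr s≈r) (normalForm Nr' t≈r') =
    NormalForm-resp (plus s≈r t≈r') (+-normal Nr Nr')

  +-absorb-repeated : ∀ A B C → AxCT ⊢ (A +ₜ B) +ₜ (C +ₜ B) ≈ A +ₜ (C +ₜ B)
  +-absorb-repeated A B C = begin
    (A +ₜ B) +ₜ (C +ₜ B)  ≈⟨ ax (A2 A B (C +ₜ B)) ⟩
    A +ₜ (B +ₜ (C +ₜ B))  ≈⟨ plus refl (plus refl (ax (A1 C B))) ⟩
    A +ₜ (B +ₜ (B +ₜ C))  ≈⟨ plus refl (ax (A2 B B C)) ⟨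
    A +ₜ ((B +ₜ B) +ₜ C)  ≈⟨ plus refl (plus (ax (A3 B)) refl) ⟩
    A +ₜ (B +ₜ C)         ≈⟨ plus refl (ax (A1 B C)) ⟩
    A +ₜ (C +ₜ B)         ∎

  ∥-distribʳ-+ : ∀ a x c r {w} z → Normal w →
    AxCT ⊢ (a · x +ₜ (c · r +ₜ w)) ∥ z ≈ (a · x ∥ z) +ₜ ((c · r +ₜ w) ∥ z)
  ∥-distribʳ-+ a x c r z nil = begin
    (a · x +ₜ (c · r +ₜ 𝟎)) ∥ z                ≈⟨ par (ax (A2 (a · x) (c · r) 𝟎)) refl ⟨
    (a · x +ₜ c · r +ₜ 𝟎) ∥ z                  ≈⟨ ax (CTP a c x r 𝟎 z) ⟩
    ((a · x +ₜ 𝟎) ∥ z) +ₜ ((c · r +ₜ 𝟎) ∥ z)  ≈⟨ plus (par (ax (A0 (a · x))) refl) refl ⟩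
    (a · x ∥ z) +ₜ ((c · r +ₜ 𝟎) ∥ z)          ∎
  ∥-distribʳ-+ a x c r z (cons d {q} {w} Nq Nw) = begin
    (a · x +ₜ (c · r +ₜ W)) ∥ z                          ≈⟨ par (ax (A2 (a · x) (c · r) W)) refl ⟨
    (a · x +ₜ c · r +ₜ W) ∥ z                            ≈⟨ ax (CTP a c x r W z) ⟩
    ((a · x +ₜ W) ∥ z) +ₜ ((c · r +ₜ W) ∥ z)            ≈⟨ plus (∥-distribʳ-+ a x d q z Nw)
                                                                 (∥-distribʳ-+ c r d q z Nw) ⟩
    ((a · x ∥ z) +ₜ (W ∥ z)) +ₜ ((c · r ∥ z) +ₜ (W ∥ z))  ≈⟨ +-absorb-repeated (a · x ∥ z) (W ∥ z) (c · r ∥ z) ⟩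
    (a · x ∥ z) +ₜ ((c · r ∥ z) +ₜ (W ∥ z))              ≈⟨ plus refl (∥-distribʳ-+ c r d q z Nw) ⟨
    (a · x ∥ z) +ₜ ((c · r +ₜ W) ∥ z)                    ∎
    where W = d · q +ₜ w

  mutual
    prefix-∥-prefix : ∀ a {p} b {q} → Normal p → Normal q → NormalForm (a · p ∥ b · q)
    prefix-∥-prefix a {p} b {q} Np Nq =
      NormalForm-resp (ax (EL1 a b p q))
        (+-normalForm
          (prefix-normalForm a (NormalForm-resp (ax (P1 p (b · q))) (prefix-∥ b Nq Np)))
          (prefix-normalForm b (prefix-∥ a Np Nq)))

    prefix-∥ : ∀ a {p t} → Normal p → Normal t → NormalForm (a · p ∥ t)
    prefix-∥ a Np nil = NormalForm-resp (ax (P0 _)) (prefix-normalForm a (normalForm Np refl))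
    prefix-∥ a Np (cons b Nq nil) =
      NormalForm-resp (par refl (ax (A0 _))) (prefix-∥-prefix a b Np Nq)
    prefix-∥ a {p} Np (cons b {q} Nq (cons c {r} {s} Nr Ns)) =
      NormalForm-resp a·p∥t≈ (+-normalForm (prefix-∥-prefix a b Np Nq) (prefix-∥ a Np (cons c Nr Ns)))
      where
      a·p∥t≈ : AxCT ⊢ a · p ∥ (b · q +ₜ (c · r +ₜ s)) ≈ (a · p ∥ b · q) +ₜ (a · p ∥ (c · r +ₜ s))
      a·p∥t≈ = begin
        a · p ∥ (b · q +ₜ (c · r +ₜ s))              ≈⟨ ax (P1 _ _) ⟩
        (b · q +ₜ (c · r +ₜ s)) ∥ a · p              ≈⟨ ∥-distribʳ-+ b q c r (a · p) Ns ⟩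
        (b · q ∥ a · p) +ₜ ((c · r +ₜ s) ∥ a · p)    ≈⟨ plus (ax (P1 _ _)) (ax (P1 _ _)) ⟩
        (a · p ∥ b · q) +ₜ (a · p ∥ (c · r +ₜ s))    ∎

  ∥-normal : ∀ {s t} → Normal s → Normal t → NormalForm (s ∥ t)
  ∥-normal {t = t} nil Nt = normalForm Nt (trans (ax (P1 𝟎 t)) (ax (P0 t)))
  ∥-normal (cons a Np nil) Nt = NormalForm-resp (par (ax (A0 _)) refl) (prefix-∥ a Np Nt)
  ∥-normal {t = t} (cons a {p} Np (cons c {r} Nr Ns)) Nt =
    NormalForm-resp (∥-distribʳ-+ a p c r t Ns)
      (+-normalForm (prefix-∥ a Np Nt) (∥-normal (cons c Nr Ns) Nt))

  ∥-normalForm : ∀ {s t} → NormalForm s → NormalForm t → NormalForm (s ∥ t)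
  ∥-normalForm (normalForm Nr s≈r) (normalForm Nr' t≈r') =
    NormalForm-resp (par s≈r t≈r') (∥-normal Nr Nr')

  normalise : ∀ {p} → Closed p → NormalForm p
  normalise 𝟎          = normalForm nil refl
  normalise (a · cp)   = prefix-normalForm a (normalise cp)
  normalise (cp +ₜ cq) = +-normalForm (normalise cp) (normalise cq)
  normalise (cp ∥ cq)  = ∥-normalForm (normalise cp) (normalise cq)

proposition5p11 : (n : ℕ) → let open Terms n in
    (p : Term) → Closed p →
    Σ Term (λ q → Closed q × BCCSP q × (AxCT ⊢ p ≈ q))
proposition5p11 n p cp with NormalForms.normalise n cp
... | NormalForms.normalForm Nr p≈r = _ , Normal⇒Closed Nr , Normal⇒BCCSP Nr , p≈r
  where open NormalForms n
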